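{- Work in $\mathbf{CZF}$. Assume NID (respectively finitary NID, elementary NID), and let $\mathcal R$ be a set of rules (respectively finitary rules, elementary rules) on a set $X$. Then there is a set $\mathcal F$ of $\mathcal R$-closed subsets of $X$ which is full: for every $\mathcal R$-closed subset $A$ of $X$ there is $F\in\mathcal F$ with $F\subseteq A$. Hence, under the same assumption, the minimal (with respect to inclusion) $\mathcal R$-closed subsets of $X$ form a set.
   Context: A rule on a set $X$ is a pair $(a,b)$ of subsets of $X$; it is elementary if $a$ is a singleton and finitary if $a$ is finite, where a set is finite if it is the image of a surjection $\{1,\dots,n\}\to a$ for some $n\in\mathbb N$. $Y\subseteq X$ is closed under $(a,b)$ if $a\subseteq Y$ implies $b\cap Y$ is inhabited; $Y$ is $\mathcal R$-closed if closed under all rules in $\mathcal R$, and $\mathrm{Clos}_{\mathcal R}(X)$ is the class of $\mathcal R$-closed subsets. A class $M$ of subsets of $X$ is set-generated if there is a set $G\subseteq M$ with $\forall\alpha\in M\,\forall x\in\alpha\,\exists\beta\in G\,x\in\beta\subseteq\alpha$. NID: for every set $X$ and set $\mathcal R$ of rules on $X$, $\mathrm{Clos}_{\mathcal R}(X)$ is set-generated; finitary (elementary) NID is the same statement restricted to sets of finitary (elementary) rules. -}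

module Defs where

open import Data.Nat using (ℕ)
open import Data.Fin using (Fin)
open import Data.Unit using (⊤)
open import Data.Product using (Σ; Σ-syntax; _×_; _,_)
open import Relation.Binary.PropositionalEquality using (_≡_)

-- Subsets of a set X (CZF sets are modelled by types in Set;
-- subsets by predicates, as in Aczel's interpretation).
Subset : Set → Set₁
Subset X = X → Set

_∈_ : {X : Set} → X → Subset X → Set
x ∈ A = A x

_⊆_ : {X : Set} → Subset X → Subset X → Set
A ⊆ B = ∀ x → A x → B x

Inhabited : {X : Set} → Subset X → Set
Inhabited {X} A = Σ X λ x → A x

Rule : Set → Set₁
Rule X = Subset X × Subset X

record RuleSet (X : Set) : Set₁ where
  field
    Idx  : Set
    rule : Idx → Rule X
open RuleSet public

IsSingleton : {X : Set} → Subset X → Set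
IsSingleton {X} a = Σ X λ x → ∀ y → (a y → y ≡ x) × (y ≡ x → a y)

IsFinite : {X : Set} → Subset X → Set
IsFinite {X} a = Σ ℕ λ n → Σ (Fin n → X) λ f →
  (∀ k → a (f k)) × (∀ y → a y → Σ (Fin n) λ k → f k ≡ y)

data Kind : Set where
  general finitary elementary : Kind

IsOfKind : Kind → {X : Set} → Rule X → Set
IsOfKind general     r = ⊤
IsOfKind finitary    (a , _) = IsFinite a
IsOfKind elementary  (a , _) = IsSingleton a

ClosedUnder : {X : Set} → Rule X → Subset X → Set
ClosedUnder (a , b) Y = a ⊆ Y → Σ _ λ x → b x × Y x

Closed : {X : Set} → RuleSet X → Subset X → Set
Closed R Y = ∀ j → ClosedUnder (rule R j) Y

record SetOfSubsets (X : Set) : Set₁ where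
  field
    Ix  : Set
    sub : Ix → Subset X
open SetOfSubsets public

ClosSetGenerated : {X : Set} → RuleSet X → Set₁
ClosSetGenerated {X} R = Σ (SetOfSubsets X) λ G →
  (∀ i → Closed R (sub G i)) ×
  (∀ α → Closed R α → ∀ x → x ∈ α →
     Σ (Ix G) λ i → (x ∈ sub G i) × (sub G i ⊆ α))

NID : Kind → Set₁
NID k = (X : Set) (R : RuleSet X) → (∀ j → IsOfKind k (rule R j)) →
        ClosSetGenerated R

FullSetOfClosed : {X : Set} → RuleSet X → Set₁
FullSetOfClosed {X} R = Σ (SetOfSubsets X) λ F →
  (∀ i → Closed R (sub F i)) ×
  (∀ A → Closed R A → Σ (Ix F) λ i → sub F i ⊆ A)

MinimalClosed : {X : Set} → RuleSet X → Subset X → Set₁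
MinimalClosed R A = Closed R A × (∀ B → Closed R B → B ⊆ A → A ⊆ B)

-- the class of minimal R-closed subsets forms a set: there is a set M
-- whose members are exactly the minimal R-closed subsets (up to
-- extensional equality of subsets)
MinimalsFormSet : {X : Set} → RuleSet X → Set₁
MinimalsFormSet {X} R = Σ (SetOfSubsets X) λ M →
  (∀ i → MinimalClosed R (sub M i)) ×
  (∀ A → MinimalClosed R A → Σ (Ix M) λ i → (sub M i ⊆ A) × (A ⊆ sub M i))

-- Adjoin a fresh point ⋆ to X and extend every rule by nothing at ⋆; this
-- keeps rules finitary (elementary).  For an R-closed A, the set A ∪ {⋆} is
-- closed under the extended rules, so NID yields a generator containing ⋆
-- and contained in A ∪ {⋆}.  Conversely, since ⋆ never appears in a
-- conclusion, the X-part of any closed set is R-closed.  Hence the X-parts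
-- of the generators containing ⋆ form a full set F, and the minimal R-closed
-- sets are exactly the members of F that are minimal within F.
module Submission where

open import Defs
open import Data.Product using (Σ; _×_; _,_; proj₁; proj₂)
open import Data.Sum using (_⊎_; inj₁; inj₂)
open import Data.Unit using (⊤; tt)
open import Data.Empty using (⊥)
open import Relation.Binary.PropositionalEquality using (_≡_; refl; cong)

⊆-trans : {X : Set} {A B C : Subset X} → A ⊆ B → B ⊆ C → A ⊆ C
⊆-trans A⊆B B⊆C x x∈A = B⊆C x (A⊆B x x∈A)

module _ {X : Set} where

  ⋆ : X ⊎ ⊤
  ⋆ = inj₂ tt

  liftSubset : Subset X → Subset (X ⊎ ⊤)
  liftSubset a (inj₁ x) = a x
  liftSubset a (inj₂ _) = ⊥

  insert⋆ : Subset X → Subset (X ⊎ ⊤)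
  insert⋆ A (inj₁ x) = A x
  insert⋆ A (inj₂ _) = ⊤

  restrict : Subset (X ⊎ ⊤) → Subset X
  restrict Y x = Y (inj₁ x)

  liftRule : Rule X → Rule (X ⊎ ⊤)
  liftRule (a , b) = liftSubset a , liftSubset b

  liftRuleSet : RuleSet X → RuleSet (X ⊎ ⊤)
  liftRuleSet R = record { Idx = Idx R ; rule = λ j → liftRule (rule R j) }

  liftSubset-isFinite : {a : Subset X} → IsFinite a → IsFinite (liftSubset a)
  liftSubset-isFinite {a} (n , f , f∈a , f-onto) = n , (λ k → inj₁ (f k)) , f∈a , onto
    where
    onto : ∀ y → liftSubset a y → Σ _ λ k → inj₁ (f k) ≡ y
    onto (inj₁ y) y∈a = let k , fk≡y = f-onto y y∈a in k , cong inj₁ fk≡y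

  liftSubset-isSingleton : {a : Subset X} → IsSingleton a → IsSingleton (liftSubset a)
  liftSubset-isSingleton {a} (x , a-is-x) = inj₁ x , equiv
    where
    equiv : ∀ y → (liftSubset a y → y ≡ inj₁ x) × (y ≡ inj₁ x → liftSubset a y)
    equiv (inj₁ y) = (λ y∈a → cong inj₁ (proj₁ (a-is-x y) y∈a))
                   , λ { refl → proj₂ (a-is-x x) refl }
    equiv (inj₂ _) = (λ ()) , λ ()

  liftRule-isOfKind : (k : Kind) (r : Rule X) → IsOfKind k r → IsOfKind k (liftRule r)
  liftRule-isOfKind general    r       _   = tt
  liftRule-isOfKind finitary   (a , b) fin = liftSubset-isFinite fin
  liftRule-isOfKind elementary (a , b) sgl = liftSubset-isSingleton sgl

  module _ (R : RuleSet X) where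

    restrict-closed : ∀ {Y} → Closed (liftRuleSet R) Y → Closed R (restrict Y)
    restrict-closed Y-closed j a⊆Y with Y-closed j (λ { (inj₁ x) → a⊆Y x })
    ... | inj₁ x , x∈b , x∈Y = x , x∈b , x∈Y

    insert⋆-closed : ∀ {A} → Closed R A → Closed (liftRuleSet R) (insert⋆ A)
    insert⋆-closed A-closed j a⊆A⋆ =
      let x , x∈b , x∈A = A-closed j (λ x → a⊆A⋆ (inj₁ x)) in inj₁ x , x∈b , x∈A

    setGenerated⇒full : ClosSetGenerated (liftRuleSet R) → FullSetOfClosed R
    setGenerated⇒full (G , G-closed , G-generates) = F , F-closed , F-full
      where
      F : SetOfSubsets X
      F = record { Ix = Σ (Ix G) λ i → ⋆ ∈ sub G i ; sub = λ (i , _) → restrict (sub G i) }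

      F-closed : ∀ i → Closed R (sub F i)
      F-closed (i , _) = restrict-closed (G-closed i)

      F-full : ∀ A → Closed R A → Σ (Ix F) λ i → sub F i ⊆ A
      F-full A A-closed =
        let i , ⋆∈Gi , Gi⊆A⋆ = G-generates (insert⋆ A) (insert⋆-closed A-closed) ⋆ tt
        in (i , ⋆∈Gi) , λ x → Gi⊆A⋆ (inj₁ x)

    full⇒minimalsFormSet : FullSetOfClosed R → MinimalsFormSet R
    full⇒minimalsFormSet (F , F-closed , F-full) = M , M-minimal , M-complete
      where
      MinimalIn-F : Ix F → Set
      MinimalIn-F i = ∀ j → sub F j ⊆ sub F i → sub F i ⊆ sub F j

      M : SetOfSubsets X
      M = record { Ix = Σ (Ix F) MinimalIn-F ; sub = λ (i , _) → sub F i }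

      M-minimal : ∀ m → MinimalClosed R (sub M m)
      M-minimal (i , i-min) = F-closed i , λ B B-closed B⊆Fi →
        let j , Fj⊆B = F-full B B-closed
        in ⊆-trans (i-min j (⊆-trans Fj⊆B B⊆Fi)) Fj⊆B

      M-complete : ∀ A → MinimalClosed R A →
                   Σ (Ix M) λ m → (sub M m ⊆ A) × (A ⊆ sub M m)
      M-complete A (A-closed , A-min) =
        let i , Fi⊆A = F-full A A-closed
            i-min : MinimalIn-F i
            i-min j Fj⊆Fi = ⊆-trans Fi⊆A (A-min (sub F j) (F-closed j) (⊆-trans Fj⊆Fi Fi⊆A))
        in (i , i-min) , Fi⊆A , A-min (sub F i) (F-closed i) Fi⊆A

proposition3p3 : (k : Kind) → NID k → (X : Set) (R : RuleSet X) →
    (∀ j → IsOfKind k (rule R j)) → FullSetOfClosed R × MinimalsFormSet R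
proposition3p3 k nid X R R-ofKind = full , full⇒minimalsFormSet R full
  where
  full : FullSetOfClosed R
  full = setGenerated⇒full R
    (nid (X ⊎ ⊤) (liftRuleSet R) λ j → liftRule-isOfKind k (rule R j) (R-ofKind j))
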